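{- Let $n\ge2$ be even, $y\in\tilde I^{\mathsf{FPF}}_n$, and let $r,t\in\tilde S_n$ be reflections with $y\ne tyt$. Let $i<j$ be integers with $j\not\equiv i\pmod n$ and $t=t_{ij}$. (a) If $y(i)\equiv j\pmod n$, then $ryr=tyt$ if and only if $r=t$. (b) If $y(i)\not\equiv j\pmod n$, then $ryr=tyt$ if and only if $r\in\{t,yty\}$.
   Context: $\tilde S_n$ is the group of bijections $\pi:\mathbb Z\to\mathbb Z$ with $\pi(i+n)=\pi(i)+n$ and $\sum_{i=1}^n\pi(i)=\sum_{i=1}^n i$. Its reflections (transpositions) are the elements $t_{ij}$, for $i<j$ with $j\not\equiv i\pmod n$, exchanging $i+kn$ and $j+kn$ for all $k\in\mathbb Z$ and fixing all other integers. $\tilde I^{\mathsf{FPF}}_n$ is the set of $z\in\tilde S_n$ with $z(z(i))=i\ne z(i)$ for all $i$. -}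

module Defs where

open import Data.Nat as ℕ using (ℕ; zero; suc)
import Data.Nat.Divisibility as ℕD
open import Data.Integer using (ℤ; +_; _+_; _-_; ∣_∣; _<_)
open import Data.Integer.Divisibility using (_∣_)
open import Data.Product using (Σ; ∃; _×_; _,_)
open import Relation.Nullary using (¬_; yes; no)
open import Relation.Binary.PropositionalEquality using (_≡_; _≢_)
open import Function using (_∘_)
open import Function.Definitions using (Bijective)

_≡_[mod_] : ℤ → ℤ → ℕ → Set
a ≡ b [mod n ] = (+ n) ∣ (a - b)

sumTo : (ℤ → ℤ) → ℕ → ℤ
sumTo f zero    = + 0
sumTo f (suc m) = sumTo f m + f (+ suc m)

record IsAffinePerm (n : ℕ) (π : ℤ → ℤ) : Set where
  field
    bijective : Bijective _≡_ _≡_ π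
    periodic  : ∀ i → π (i + + n) ≡ π i + + n
    sumCond   : sumTo π n ≡ sumTo (λ i → i) n

record IsFPFInvolution (n : ℕ) (z : ℤ → ℤ) : Set where
  field
    affine   : IsAffinePerm n z
    involut  : ∀ i → z (z i) ≡ i
    fixFree  : ∀ i → z i ≢ i

-- the reflection t_{ij}: exchanges i+kn and j+kn for all k, fixes everything else
-- (meaningful when i < j and j ≢ i mod n)
tr : ℕ → ℤ → ℤ → ℤ → ℤ
tr n i j x with n ℕD.∣? ∣ x - i ∣
... | yes _ = x + (j - i)
... | no _ with n ℕD.∣? ∣ x - j ∣
...   | yes _ = x - (j - i)
...   | no _  = x

IsReflection : ℕ → (ℤ → ℤ) → Set
IsReflection n r =
  Σ ℤ λ i → Σ ℤ λ j → i < j × ¬ (j ≡ i [mod n ]) × (∀ x → r x ≡ tr n i j x)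

_≐_ : (ℤ → ℤ) → (ℤ → ℤ) → Set
f ≐ g = ∀ x → f x ≡ g x

conj : (ℤ → ℤ) → (ℤ → ℤ) → (ℤ → ℤ)
conj a b = a ∘ b ∘ a

{-# OPTIONS --safe #-}
-- Write z = t y t with t = t_ij.  A reflection r = t_ab is recovered from any point c it
-- moves together with r c, and for fixed c the value (t_cd y t_cd)(c) determines d among
-- d ≢ c (mod n).  If r y r = z then r moves i or y i, because z i ≠ y i (y i ≠ j: in case (a)
-- this is where y ≠ z is used).  In case (a) the class of y i is that of j, so r moves i or j
-- and comparing at that point gives r = t_ij = t_ji.  In case (b) comparing at y i gives
-- r = t_(y i)(y j) = y t y, which also conjugates y to z because t and y t y have disjoint
-- supports and therefore commute.
module Submission where

open import Defs
open import Data.Nat using (ℕ; _≤_)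
open import Data.Nat.Divisibility using () renaming (_∣_ to _∣ℕ_)
open import Data.Integer using (ℤ; _<_)
open import Data.Product using (_×_)
open import Data.Sum using (_⊎_)
open import Relation.Nullary using (¬_)
open import Function.Bundles using (_⇔_)

open import Data.Nat as ℕ using (zero; suc)
import Data.Nat.Divisibility as ℕD
open import Data.Integer using (+_; -[1+_]; _+_; _-_; _*_; -_; ∣_∣; 0ℤ)
import Data.Integer.Properties as ℤ
open import Data.Integer.Divisibility.Signed using (divides; ∣ᵤ⇒∣; ∣⇒∣ᵤ)
open import Data.Integer.Tactic.RingSolver using (solve-∀)
open import Data.Product using (∃-syntax; _,_)
open import Data.Sum using (inj₁; inj₂; [_,_]′)
open import Data.Empty using (⊥-elim)
open import Relation.Nullary using (Dec; yes; no)
open import Relation.Nullary.Decidable using (map′; _⊎-dec_)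
open import Relation.Binary.PropositionalEquality
open import Function using (_∘_)
open import Function.Bundles using (mk⇔)

conj-congˡ : ∀ {r s y : ℤ → ℤ} → r ≐ s → conj r y ≐ conj s y
conj-congˡ {r} {s} {y} r≐s x = trans (cong (r ∘ y) (r≐s x)) (r≐s (y (s x)))

conj-conj-involution : ∀ {t y : ℤ → ℤ} → (∀ x → y (y x) ≡ x) →
  (∀ x → t (conj y t x) ≡ conj y t (t x)) → conj (conj y t) y ≐ conj t y
conj-conj-involution {t} {y} involutive commute x = begin
  y (t (y (y (y (t (y x))))))  ≡⟨ cong (y ∘ t) (involutive (y (t (y x)))) ⟩
  y (t (y (t (y x))))          ≡⟨ sym (commute (y x)) ⟩
  t (y (t (y (y x))))          ≡⟨ cong (t ∘ y ∘ t) (involutive x) ⟩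
  t (y (t x))                  ∎
  where open ≡-Reasoning

module Congruence (n : ℕ) .{{_ : ℕ.NonZero n}} where

  infix 4 _≈_ _≉_

  -- A record rather than a synonym, so that both sides are recovered by unification.
  record _≈_ (x c : ℤ) : Set where
    constructor mk≈
    field get≈ : x ≡ c [mod n ]
  open _≈_ public

  _≉_ : ℤ → ℤ → Set
  x ≉ c = ¬ x ≈ c

  _≈?_ : ∀ x c → Dec (x ≈ c)
  x ≈? c = map′ mk≈ get≈ (n ℕD.∣? ∣ x - c ∣)

  ≈⇒shift : ∀ {x c} → x ≈ c → ∃[ k ] x ≡ c + k * + n
  ≈⇒shift {x} {c} (mk≈ p) with ∣ᵤ⇒∣ {+ n} {x - c} p
  ... | divides k x-c≡kn = k , (begin
    x            ≡⟨ rearrange x c ⟩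
    x - c + c    ≡⟨ cong (_+ c) x-c≡kn ⟩
    k * + n + c  ≡⟨ ℤ.+-comm (k * + n) c ⟩
    c + k * + n  ∎)
    where
      open ≡-Reasoning
      rearrange : ∀ x c → x ≡ x - c + c
      rearrange = solve-∀

  shift⇒≈ : ∀ {x c} k → x ≡ c + k * + n → x ≈ c
  shift⇒≈ {x} {c} k refl = mk≈ (∣⇒∣ᵤ (divides k (cancel c (k * + n))))
    where
      cancel : ∀ c u → c + u - c ≡ u
      cancel = solve-∀

  c+0*n≡c : ∀ c → c + 0ℤ * + n ≡ c
  c+0*n≡c = ℤ.+-identityʳ

  ≈-refl : ∀ {x} → x ≈ x
  ≈-refl {x} = shift⇒≈ 0ℤ (sym (c+0*n≡c x))

  ≈-reflexive : ∀ {x c} → x ≡ c → x ≈ c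
  ≈-reflexive refl = ≈-refl

  ≈-sym : ∀ {x c} → x ≈ c → c ≈ x
  ≈-sym {x} {c} p with ≈⇒shift p
  ... | k , refl = shift⇒≈ (- k) (undo c k (+ n))
    where
      undo : ∀ c k n → c ≡ c + k * n + (- k) * n
      undo = solve-∀

  ≈-trans : ∀ {x c d} → x ≈ c → c ≈ d → x ≈ d
  ≈-trans {d = d} p q with ≈⇒shift p | ≈⇒shift q
  ... | k , refl | l , refl = shift⇒≈ (l + k) (collect d l k (+ n))
    where
      collect : ∀ d l k n → d + l * n + k * n ≡ d + (l + k) * n
      collect = solve-∀

  ≈-+ʳ : ∀ {x c} u → x ≈ c → x + u ≈ c + u
  ≈-+ʳ {c = c} u p with ≈⇒shift p
  ... | k , refl = shift⇒≈ k (swap c k u (+ n))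
    where
      swap : ∀ c k u n → c + k * n + u ≡ c + u + k * n
      swap = solve-∀

  c+[k+k]*n≡c⇒k≡0 : ∀ c k → c + (k + k) * + n ≡ c → k ≡ 0ℤ
  c+[k+k]*n≡c⇒k≡0 c k eq =
    ℤ.*-cancelʳ-≡ k 0ℤ (+ 2) (trans (double k) (ℤ.*-cancelʳ-≡ (k + k) 0ℤ (+ n) multiple≡0))
    where
      double : ∀ k → k * + 2 ≡ k + k
      double = solve-∀
      difference : ∀ c u → u ≡ c + u - c
      difference = solve-∀
      multiple≡0 : (k + k) * + n ≡ 0ℤ
      multiple≡0 = trans (difference c _) (trans (cong (_- c) eq) (ℤ.+-inverseʳ c))

  periodic⇒shift : ∀ {f : ℤ → ℤ} → (∀ x → f (x + + n) ≡ f x + + n) →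
                   ∀ k x → f (x + k * + n) ≡ f x + k * + n
  periodic⇒shift {f} periodic = shift
    where
      N : ℤ
      N = + n
      shift⁺ : ∀ k x → f (x + + k * N) ≡ f x + + k * N
      shift⁺ zero x = trans (cong f (c+0*n≡c x)) (sym (c+0*n≡c (f x)))
      shift⁺ (suc k) x = begin
        f (x + + suc k * N)      ≡⟨ cong f (peel x (+ k) N) ⟩
        f (x + + k * N + N)      ≡⟨ periodic (x + + k * N) ⟩
        f (x + + k * N) + N      ≡⟨ cong (_+ N) (shift⁺ k x) ⟩
        f x + + k * N + N        ≡⟨ sym (peel (f x) (+ k) N) ⟩
        f x + + suc k * N        ∎
        where
          open ≡-Reasoning
          peel : ∀ x k N → x + (+ 1 + k) * N ≡ x + k * N + N
          peel = solve-∀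
      shift : ∀ k x → f (x + k * N) ≡ f x + k * N
      shift (+ k) = shift⁺ k
      shift -[1+ k ] x = begin
        f x′                          ≡⟨ undo (f x′) K N ⟩
        f x′ + K * N + (- K) * N      ≡⟨ cong (_+ (- K) * N) (sym (shift⁺ (suc k) x′)) ⟩
        f (x′ + K * N) + (- K) * N    ≡⟨ cong (λ u → f u + (- K) * N) (redo x K N) ⟩
        f x + (- K) * N               ∎
        where
          open ≡-Reasoning
          K : ℤ
          K = + suc k
          x′ : ℤ
          x′ = x + (- K) * N
          undo : ∀ b K N → b ≡ b + K * N + (- K) * N
          undo = solve-∀
          redo : ∀ x K N → x + (- K) * N + K * N ≡ x
          redo = solve-∀

module Reflection (n : ℕ) .{{_ : ℕ.NonZero n}} where
  open Congruence n

  Moves : ℤ → ℤ → ℤ → Set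
  Moves c d x = x ≈ c ⊎ x ≈ d

  moves? : ∀ c d x → Dec (Moves c d x)
  moves? c d x = (x ≈? c) ⊎-dec (x ≈? d)

  Moves-resp-≈ : ∀ {c d x x′} → x ≈ x′ → Moves c d x → Moves c d x′
  Moves-resp-≈ x≈x′ (inj₁ x≈c) = inj₁ (≈-trans (≈-sym x≈x′) x≈c)
  Moves-resp-≈ x≈x′ (inj₂ x≈d) = inj₂ (≈-trans (≈-sym x≈x′) x≈d)

  tr-≈ˡ : ∀ {c d x} → x ≈ c → tr n c d x ≡ x + (d - c)
  tr-≈ˡ {c} {d} {x} x≈c with n ℕD.∣? ∣ x - c ∣
  ... | yes _   = refl
  ... | no x≉c  = ⊥-elim (x≉c (get≈ x≈c))

  tr-≈ʳ : ∀ {c d x} → x ≉ c → x ≈ d → tr n c d x ≡ x - (d - c)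
  tr-≈ʳ {c} {d} {x} x≉c x≈d with n ℕD.∣? ∣ x - c ∣
  ... | yes x≈c = ⊥-elim (x≉c (mk≈ x≈c))
  ... | no _ with n ℕD.∣? ∣ x - d ∣
  ...   | yes _  = refl
  ...   | no x≉d = ⊥-elim (x≉d (get≈ x≈d))

  tr-fixed : ∀ {c d x} → ¬ Moves c d x → tr n c d x ≡ x
  tr-fixed {c} {d} {x} unmoved with n ℕD.∣? ∣ x - c ∣
  ... | yes x≈c = ⊥-elim (unmoved (inj₁ (mk≈ x≈c)))
  ... | no _ with n ℕD.∣? ∣ x - d ∣
  ...   | yes x≈d = ⊥-elim (unmoved (inj₂ (mk≈ x≈d)))
  ...   | no _    = refl

  tr-start : ∀ c d → tr n c d c ≡ d
  tr-start c d = trans (tr-≈ˡ ≈-refl) (c+[d-c]≡d c d)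
    where
      c+[d-c]≡d : ∀ c d → c + (d - c) ≡ d
      c+[d-c]≡d = solve-∀

  tr-≈ˡ-image : ∀ {c d x} → x ≈ c → tr n c d x ≈ d
  tr-≈ˡ-image {c} {d} {x} x≈c =
    subst₂ _≈_ (sym (tr-≈ˡ x≈c)) (c+[d-c]≡d c d) (≈-+ʳ (d - c) x≈c)
    where
      c+[d-c]≡d : ∀ c d → c + (d - c) ≡ d
      c+[d-c]≡d = solve-∀

  tr-≈ʳ-image : ∀ {c d x} → x ≉ c → x ≈ d → tr n c d x ≈ c
  tr-≈ʳ-image {c} {d} {x} x≉c x≈d =
    subst₂ _≈_ (sym (tr-≈ʳ x≉c x≈d)) (d-[d-c]≡c c d) (≈-+ʳ (- (d - c)) x≈d)
    where
      d-[d-c]≡c : ∀ c d → d - (d - c) ≡ c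
      d-[d-c]≡c = solve-∀

  tr-preserves-Moves : ∀ {c d x} → Moves c d x → Moves c d (tr n c d x)
  tr-preserves-Moves {c} {d} {x} moved with x ≈? c | moved
  ... | yes x≈c | _        = inj₂ (tr-≈ˡ-image x≈c)
  ... | no x≉c  | inj₁ x≈c = ⊥-elim (x≉c x≈c)
  ... | no x≉c  | inj₂ x≈d = inj₁ (tr-≈ʳ-image x≉c x≈d)

  tr-changes-class : ∀ {c d x} → c ≉ d → Moves c d x → x ≉ tr n c d x
  tr-changes-class {c} {d} {x} c≉d moved with x ≈? c | moved
  ... | yes x≈c | _        = λ x≈tx → c≉d (≈-trans (≈-sym x≈c) (≈-trans x≈tx (tr-≈ˡ-image x≈c)))
  ... | no x≉c  | inj₁ x≈c = ⊥-elim (x≉c x≈c)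
  ... | no x≉c  | inj₂ x≈d = λ x≈tx → x≉c (≈-trans x≈tx (tr-≈ʳ-image x≉c x≈d))

  tr-involutive : ∀ {c d} → c ≉ d → ∀ x → tr n c d (tr n c d x) ≡ x
  tr-involutive {c} {d} c≉d x with x ≈? c
  ... | yes x≈c = begin
    tr n c d (tr n c d x)    ≡⟨ tr-≈ʳ tx≉c (tr-≈ˡ-image x≈c) ⟩
    tr n c d x - (d - c)     ≡⟨ cong (_- (d - c)) (tr-≈ˡ x≈c) ⟩
    x + (d - c) - (d - c)    ≡⟨ cancel x (d - c) ⟩
    x                        ∎
    where
      open ≡-Reasoning
      tx≉c : tr n c d x ≉ c
      tx≉c tx≈c = c≉d (≈-trans (≈-sym tx≈c) (tr-≈ˡ-image x≈c))
      cancel : ∀ x u → x + u - u ≡ x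
      cancel = solve-∀
  ... | no x≉c with x ≈? d
  ...   | yes x≈d = begin
    tr n c d (tr n c d x)    ≡⟨ tr-≈ˡ (tr-≈ʳ-image x≉c x≈d) ⟩
    tr n c d x + (d - c)     ≡⟨ cong (_+ (d - c)) (tr-≈ʳ x≉c x≈d) ⟩
    x - (d - c) + (d - c)    ≡⟨ cancel x (d - c) ⟩
    x                        ∎
    where
      open ≡-Reasoning
      cancel : ∀ x u → x - u + u ≡ x
      cancel = solve-∀
  ...   | no x≉d =
    trans (cong (tr n c d) (tr-fixed unmoved)) (tr-fixed unmoved)
    where
      unmoved : ¬ Moves c d x
      unmoved (inj₁ x≈c) = x≉c x≈c
      unmoved (inj₂ x≈d) = x≉d x≈d

  tr-sym : ∀ {c d} → c ≉ d → tr n c d ≐ tr n d c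
  tr-sym {c} {d} c≉d x with x ≈? c
  ... | yes x≈c =
    trans (tr-≈ˡ x≈c) (trans (flip x c d) (sym (tr-≈ʳ (λ x≈d → c≉d (≈-trans (≈-sym x≈c) x≈d)) x≈c)))
    where
      flip : ∀ x c d → x + (d - c) ≡ x - (c - d)
      flip = solve-∀
  ... | no x≉c with x ≈? d
  ...   | yes x≈d = trans (tr-≈ʳ x≉c x≈d) (trans (flip x c d) (sym (tr-≈ˡ x≈d)))
    where
      flip : ∀ x c d → x - (d - c) ≡ x + (c - d)
      flip = solve-∀
  ...   | no x≉d = trans (tr-fixed unmoved) (sym (tr-fixed (unmoved ∘ swap)))
    where
      unmoved : ¬ Moves c d x
      unmoved (inj₁ x≈c) = x≉c x≈c
      unmoved (inj₂ x≈d) = x≉d x≈d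
      swap : Moves d c x → Moves c d x
      swap (inj₁ x≈d) = inj₂ x≈d
      swap (inj₂ x≈c) = inj₁ x≈c

  tr-cong : ∀ {c d c′ d′} → c ≈ c′ → d ≈ d′ → d - c ≡ d′ - c′ → tr n c d ≐ tr n c′ d′
  tr-cong {c} {d} {c′} {d′} c≈c′ d≈d′ same-offset x with x ≈? c
  ... | yes x≈c =
    trans (tr-≈ˡ x≈c) (trans (cong (λ u → x + u) same-offset) (sym (tr-≈ˡ (≈-trans x≈c c≈c′))))
  ... | no x≉c with x ≈? d
  ...   | yes x≈d =
    trans (tr-≈ʳ x≉c x≈d) (trans (cong (λ u → x - u) same-offset) (sym (tr-≈ʳ x≉c′ (≈-trans x≈d d≈d′))))
    where
      x≉c′ : x ≉ c′
      x≉c′ x≈c′ = x≉c (≈-trans x≈c′ (≈-sym c≈c′))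
  ...   | no x≉d = trans (tr-fixed unmoved) (sym (tr-fixed unmoved′))
    where
      unmoved : ¬ Moves c d x
      unmoved (inj₁ x≈c) = x≉c x≈c
      unmoved (inj₂ x≈d) = x≉d x≈d
      unmoved′ : ¬ Moves c′ d′ x
      unmoved′ (inj₁ x≈c′) = x≉c (≈-trans x≈c′ (≈-sym c≈c′))
      unmoved′ (inj₂ x≈d′) = x≉d (≈-trans x≈d′ (≈-sym d≈d′))

  tr-at-moved : ∀ {c d x} → c ≉ d → Moves c d x → tr n c d ≐ tr n x (tr n c d x)
  tr-at-moved {c} {d} {x} c≉d (inj₁ x≈c) = at-first x≈c
    where
      at-first : ∀ {c d x} → x ≈ c → tr n c d ≐ tr n x (tr n c d x)
      at-first {c} {d} {x} x≈c = tr-cong (≈-sym x≈c) (≈-sym (tr-≈ˡ-image x≈c))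
        (trans (offset x c d) (cong (_- x) (sym (tr-≈ˡ x≈c))))
        where
          offset : ∀ x c d → d - c ≡ x + (d - c) - x
          offset = solve-∀
  tr-at-moved {c} {d} {x} c≉d (inj₂ x≈d) w = begin
    tr n c d w               ≡⟨ tr-sym c≉d w ⟩
    tr n d c w               ≡⟨ tr-at-moved (c≉d ∘ ≈-sym) (inj₁ x≈d) w ⟩
    tr n x (tr n d c x) w    ≡⟨ cong (λ e → tr n x e w) (sym (tr-sym c≉d x)) ⟩
    tr n x (tr n c d x) w    ∎
    where open ≡-Reasoning

  tr-comm : ∀ {c d e f} → (∀ {x} → Moves c d x → ¬ Moves e f x) →
            ∀ w → tr n c d (tr n e f w) ≡ tr n e f (tr n c d w)
  tr-comm {c} {d} {e} {f} disjoint w with moves? c d w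
  ... | yes moved = trans (cong (tr n c d) (tr-fixed (disjoint moved)))
                          (sym (tr-fixed (disjoint (tr-preserves-Moves moved))))
  ... | no unmoved with moves? e f w
  ...   | yes moved′ = trans (tr-fixed (λ m → disjoint m (tr-preserves-Moves moved′)))
                             (cong (tr n e f) (sym (tr-fixed unmoved)))
  ...   | no unmoved′ = begin
    tr n c d (tr n e f w)    ≡⟨ cong (tr n c d) (tr-fixed unmoved′) ⟩
    tr n c d w               ≡⟨ tr-fixed unmoved ⟩
    w                        ≡⟨ sym (tr-fixed unmoved′) ⟩
    tr n e f w               ≡⟨ cong (tr n e f) (sym (tr-fixed unmoved)) ⟩
    tr n e f (tr n c d w)    ∎
    where open ≡-Reasoning

module FPFInvolution (n : ℕ) .{{_ : ℕ.NonZero n}} (y : ℤ → ℤ) (Y : IsFPFInvolution n y) where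
  open Congruence n
  open Reflection n
  open IsFPFInvolution Y
  open IsAffinePerm affine using (periodic)

  y-shift : ∀ k x → y (x + k * + n) ≡ y x + k * + n
  y-shift = periodic⇒shift {y} periodic

  y-injective : ∀ {a b} → y a ≡ y b → a ≡ b
  y-injective {a} {b} ya≡yb = trans (sym (involut a)) (trans (cong y ya≡yb) (involut b))

  y-resp-≈ : ∀ {x c} → x ≈ c → y x ≈ y c
  y-resp-≈ x≈c with ≈⇒shift x≈c
  ... | k , refl = shift⇒≈ k (y-shift k _)

  y-≈ˡ : ∀ {x c} → y x ≈ c → x ≈ y c
  y-≈ˡ {x} {c} yx≈c = subst (_≈ y c) (involut x) (y-resp-≈ yx≈c)

  y-≈ʳ : ∀ {x c} → x ≈ y c → y x ≈ c
  y-≈ʳ {x} {c} x≈yc = subst (y x ≈_) (involut c) (y-resp-≈ x≈yc)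

  y-≉-id : ∀ x → y x ≉ x
  y-≉-id x yx≈x with ≈⇒shift yx≈x
  ... | k , yx≡x+kn = fixFree x (begin
    y x              ≡⟨ yx≡x+kn ⟩
    x + k * + n      ≡⟨ cong (λ k → x + k * + n) k≡0 ⟩
    x + 0ℤ * + n     ≡⟨ c+0*n≡c x ⟩
    x                ∎)
    where
      open ≡-Reasoning
      collect : ∀ x k n → x + k * n + k * n ≡ x + (k + k) * n
      collect = solve-∀
      k≡0 : k ≡ 0ℤ
      k≡0 = c+[k+k]*n≡c⇒k≡0 x k (begin
        x + (k + k) * + n      ≡⟨ sym (collect x k (+ n)) ⟩
        x + k * + n + k * + n  ≡⟨ cong (_+ k * + n) (sym yx≡x+kn) ⟩
        y x + k * + n          ≡⟨ sym (y-shift k x) ⟩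
        y (x + k * + n)        ≡⟨ cong y (sym yx≡x+kn) ⟩
        y (y x)                ≡⟨ involut x ⟩
        x                      ∎)

  y+id-injective-on-≈ : ∀ {d e} → d ≈ e → y d + d ≡ y e + e → d ≡ e
  y+id-injective-on-≈ {d} {e} d≈e same with ≈⇒shift d≈e
  ... | k , refl = trans (cong (λ k → e + k * + n) k≡0) (c+0*n≡c e)
    where
      collect : ∀ ye e k n → ye + k * n + (e + k * n) ≡ ye + e + (k + k) * n
      collect = solve-∀
      k≡0 : k ≡ 0ℤ
      k≡0 = c+[k+k]*n≡c⇒k≡0 (y e + e) k (begin
        y e + e + (k + k) * + n          ≡⟨ sym (collect (y e) e k (+ n)) ⟩
        y e + k * + n + (e + k * + n)    ≡⟨ cong (_+ (e + k * + n)) (sym (y-shift k e)) ⟩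
        y (e + k * + n) + (e + k * + n)  ≡⟨ same ⟩
        y e + e                          ∎)
        where open ≡-Reasoning

  conj-y-tr-≈ˡ : ∀ {c d x} → y x ≈ c → conj y (tr n c d) x ≡ tr n (y c) (y d) x
  conj-y-tr-≈ˡ {c} {d} {x} yx≈c with ≈⇒shift yx≈c
  ... | k , yx≡c+kn = begin
    y (tr n c d (y x))           ≡⟨ cong y (tr-≈ˡ yx≈c) ⟩
    y (y x + (d - c))            ≡⟨ cong (λ u → y (u + (d - c))) yx≡c+kn ⟩
    y (c + k * + n + (d - c))    ≡⟨ cong y (rotate c d k (+ n)) ⟩
    y (d + k * + n)              ≡⟨ y-shift k d ⟩
    y d + k * + n                ≡⟨ sym (rotate (y c) (y d) k (+ n)) ⟩
    y c + k * + n + (y d - y c)  ≡⟨ cong (_+ (y d - y c)) (sym x≡yc+kn) ⟩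
    x + (y d - y c)              ≡⟨ sym (tr-≈ˡ (y-≈ˡ yx≈c)) ⟩
    tr n (y c) (y d) x           ∎
    where
      open ≡-Reasoning
      rotate : ∀ c d k n → c + k * n + (d - c) ≡ d + k * n
      rotate = solve-∀
      x≡yc+kn : x ≡ y c + k * + n
      x≡yc+kn = trans (sym (involut x)) (trans (cong y yx≡c+kn) (y-shift k c))

  y-tr-y : ∀ {c d} → c ≉ d → conj y (tr n c d) ≐ tr n (y c) (y d)
  y-tr-y {c} {d} c≉d x with y x ≈? c
  ... | yes yx≈c = conj-y-tr-≈ˡ yx≈c
  ... | no yx≉c with y x ≈? d
  ...   | yes yx≈d = begin
    y (tr n c d (y x))   ≡⟨ cong y (tr-sym c≉d (y x)) ⟩
    y (tr n d c (y x))   ≡⟨ conj-y-tr-≈ˡ yx≈d ⟩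
    tr n (y d) (y c) x   ≡⟨ sym (tr-sym yc≉yd x) ⟩
    tr n (y c) (y d) x   ∎
    where
      open ≡-Reasoning
      yc≉yd : y c ≉ y d
      yc≉yd yc≈yd = c≉d (subst (c ≈_) (involut d) (y-≈ˡ yc≈yd))
  ...   | no yx≉d =
    trans (cong y (tr-fixed unmoved)) (trans (involut x) (sym (tr-fixed unmoved′)))
    where
      unmoved : ¬ Moves c d (y x)
      unmoved (inj₁ yx≈c) = yx≉c yx≈c
      unmoved (inj₂ yx≈d) = yx≉d yx≈d
      unmoved′ : ¬ Moves (y c) (y d) x
      unmoved′ (inj₁ x≈yc) = yx≉c (y-≈ʳ x≈yc)
      unmoved′ (inj₂ x≈yd) = yx≉d (y-≈ʳ x≈yd)

  conj-tr-trivial : ∀ {c d} → c ≉ d → y c ≡ d → conj (tr n c d) y ≐ y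
  conj-tr-trivial {c} {d} c≉d yc≡d x =
    trans (cong (tr n c d) (y-commutes x)) (tr-involutive c≉d (y x))
    where
      yd≡c : y d ≡ c
      yd≡c = trans (cong y (sym yc≡d)) (involut c)
      y-commutes : ∀ w → y (tr n c d w) ≡ tr n c d (y w)
      y-commutes w = begin
        y (tr n c d w)           ≡⟨ cong (y ∘ tr n c d) (sym (involut w)) ⟩
        y (tr n c d (y (y w)))   ≡⟨ y-tr-y c≉d (y w) ⟩
        tr n (y c) (y d) (y w)   ≡⟨ cong₂ (λ a b → tr n a b (y w)) yc≡d yd≡c ⟩
        tr n d c (y w)           ≡⟨ sym (tr-sym c≉d (y w)) ⟩
        tr n c d (y w)           ∎
        where open ≡-Reasoning

  conj-tr-support : ∀ {c d x} → conj (tr n c d) y x ≢ y x → Moves c d x ⊎ Moves c d (y x)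
  conj-tr-support {c} {d} {x} changed with moves? c d x | moves? c d (y x)
  ... | yes moved | _          = inj₁ moved
  ... | no _      | yes moved  = inj₂ moved
  ... | no fixed  | no fixed′  =
    ⊥-elim (changed (trans (cong (tr n c d ∘ y) (tr-fixed fixed)) (tr-fixed fixed′)))

  conj-tr-start : ∀ c d → conj (tr n c d) y c ≡ tr n c d (y d)
  conj-tr-start c d = cong (tr n c d ∘ y) (tr-start c d)

  conj-tr-start-≈ : ∀ {c d} → y d ≈ c → conj (tr n c d) y c ≡ y d + (d - c)
  conj-tr-start-≈ {c} {d} yd≈c = trans (conj-tr-start c d) (tr-≈ˡ yd≈c)

  conj-tr-start-≉ : ∀ {c d} → y d ≉ c → conj (tr n c d) y c ≡ y d
  conj-tr-start-≉ {c} {d} yd≉c = trans (conj-tr-start c d) (tr-fixed unmoved)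
    where
      unmoved : ¬ Moves c d (y d)
      unmoved (inj₁ yd≈c) = yd≉c yd≈c
      unmoved (inj₂ yd≈d) = y-≉-id d yd≈d

  conj-tr-start-injective : ∀ {c d e} → c ≉ d → c ≉ e →
                            conj (tr n c d) y c ≡ conj (tr n c e) y c → d ≡ e
  conj-tr-start-injective {c} {d} {e} c≉d c≉e same = cases (y d ≈? c) (y e ≈? c)
    where
      open ≡-Reasoning
      add-back : ∀ a d c → a + d ≡ a + (d - c) + c
      add-back = solve-∀
      -- If only y d ≈ c, then the value lies in the class of d but equals y e, so e ≈ y d ≈ c.
      mixed : ∀ {d e} → y d ≈ c → y e ≉ c → c ≉ e →
              conj (tr n c d) y c ≢ conj (tr n c e) y c
      mixed {d} {e} yd≈c ye≉c c≉e same′ = c≉e (≈-sym (≈-trans (y-≈ˡ ye≈d) yd≈c))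
        where
          ye≈d : y e ≈ d
          ye≈d = subst (_≈ d) (trans (sym (conj-tr-start c d)) (trans same′ (conj-tr-start-≉ ye≉c)))
                   (tr-≈ˡ-image yd≈c)
      cases : Dec (y d ≈ c) → Dec (y e ≈ c) → d ≡ e
      cases (yes yd≈c) (yes ye≈c) = y+id-injective-on-≈ d≈e (begin
        y d + d              ≡⟨ add-back (y d) d c ⟩
        y d + (d - c) + c    ≡⟨ cong (_+ c) (trans (sym (conj-tr-start-≈ yd≈c)) same) ⟩
        conj (tr n c e) y c + c  ≡⟨ cong (_+ c) (conj-tr-start-≈ ye≈c) ⟩
        y e + (e - c) + c    ≡⟨ sym (add-back (y e) e c) ⟩
        y e + e              ∎)
        where
          d≈e : d ≈ e
          d≈e = subst (d ≈_) (involut e) (y-≈ˡ (≈-trans yd≈c (≈-sym ye≈c)))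
      cases (yes yd≈c) (no ye≉c) = ⊥-elim (mixed yd≈c ye≉c c≉e same)
      cases (no yd≉c) (yes ye≈c) = ⊥-elim (mixed ye≈c yd≉c c≉d (sym same))
      cases (no yd≉c) (no ye≉c)  =
        y-injective (trans (sym (conj-tr-start-≉ yd≉c)) (trans same (conj-tr-start-≉ ye≉c)))

  conj-tr-start-≢ : ∀ {c d} → c ≉ d → y c ≢ d → conj (tr n c d) y c ≢ y c
  conj-tr-start-≢ {c} {d} c≉d yc≢d fixes =
    yc≢d (sym (conj-tr-start-injective c≉d c≉yc (trans fixes (sym fixes′))))
    where
      c≉yc : c ≉ y c
      c≉yc c≈yc = y-≉-id c (≈-sym c≈yc)
      fixes′ : conj (tr n c (y c)) y c ≡ y c
      fixes′ = trans (conj-tr-start c (y c)) (trans (cong (tr n c (y c)) (involut c)) (tr-start c (y c)))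

  reflection-determined : ∀ {r a b c e} → a ≉ b → r ≐ tr n a b → Moves a b c → c ≉ e →
                          conj r y ≐ conj (tr n c e) y → r ≐ tr n c e
  reflection-determined {r} {a} {b} {c} {e} a≉b r≐tab moved c≉e same x = begin
    r x                     ≡⟨ r≐tc x ⟩
    tr n c (tr n a b c) x   ≡⟨ cong (λ d → tr n c d x) image≡e ⟩
    tr n c e x              ∎
    where
      open ≡-Reasoning
      r≐tc : r ≐ tr n c (tr n a b c)
      r≐tc w = trans (r≐tab w) (tr-at-moved a≉b moved w)
      image≡e : tr n a b c ≡ e
      image≡e = conj-tr-start-injective (tr-changes-class a≉b moved) c≉e
                  (trans (sym (conj-congˡ {y = y} r≐tc c)) (same c))

  same-conj⇒Moves : ∀ {r a b c d} → r ≐ tr n a b → c ≉ d → y c ≢ d →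
                    conj r y ≐ conj (tr n c d) y → Moves a b c ⊎ Moves a b (y c)
  same-conj⇒Moves {r} {a} {b} {c} {d} r≐tab c≉d yc≢d same = conj-tr-support fixes⇒⊥
    where
      fixes⇒⊥ : conj (tr n a b) y c ≢ y c
      fixes⇒⊥ fixes = conj-tr-start-≢ c≉d yc≢d
        (trans (sym (same c)) (trans (conj-congˡ {y = y} r≐tab c) fixes))

  same-conj⇒≐-tr : ∀ {r a b i j} → a ≉ b → r ≐ tr n a b → i ≉ j → y i ≈ j →
                   ¬ (y ≐ conj (tr n i j) y) → conj r y ≐ conj (tr n i j) y → r ≐ tr n i j
  same-conj⇒≐-tr {r} {a} {b} {i} {j} a≉b r≐tab i≉j yi≈j nontrivial same =
    [ from-i , from-yi ]′ (same-conj⇒Moves r≐tab i≉j yi≢j same)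
    where
      yi≢j : y i ≢ j
      yi≢j yi≡j = nontrivial (λ x → sym (conj-tr-trivial i≉j yi≡j x))
      from-i : Moves a b i → r ≐ tr n i j
      from-i i-moved = reflection-determined a≉b r≐tab i-moved i≉j same
      same′ : conj r y ≐ conj (tr n j i) y
      same′ x = trans (same x) (conj-congˡ {y = y} (tr-sym i≉j) x)
      from-yi : Moves a b (y i) → r ≐ tr n i j
      from-yi yi-moved x =
        trans (reflection-determined a≉b r≐tab (Moves-resp-≈ yi≈j yi-moved) (i≉j ∘ ≈-sym) same′ x)
              (sym (tr-sym i≉j x))

  conj-ytry≐conj-tr : ∀ {i j} → i ≉ j → y i ≉ j → conj (conj y (tr n i j)) y ≐ conj (tr n i j) y
  conj-ytry≐conj-tr {i} {j} i≉j yi≉j = conj-conj-involution {tr n i j} {y} involut commute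
    where
      disjoint : ∀ {x} → Moves i j x → ¬ Moves (y i) (y j) x
      disjoint (inj₁ x≈i) (inj₁ x≈yi) = y-≉-id i (≈-sym (≈-trans (≈-sym x≈i) x≈yi))
      disjoint (inj₁ x≈i) (inj₂ x≈yj) = yi≉j (y-≈ʳ (≈-trans (≈-sym x≈i) x≈yj))
      disjoint (inj₂ x≈j) (inj₁ x≈yi) = yi≉j (≈-sym (≈-trans (≈-sym x≈j) x≈yi))
      disjoint (inj₂ x≈j) (inj₂ x≈yj) = y-≉-id j (≈-sym (≈-trans (≈-sym x≈j) x≈yj))
      commute : ∀ x → tr n i j (conj y (tr n i j) x) ≡ conj y (tr n i j) (tr n i j x)
      commute x = begin
        tr n i j (conj y (tr n i j) x)      ≡⟨ cong (tr n i j) (y-tr-y i≉j x) ⟩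
        tr n i j (tr n (y i) (y j) x)       ≡⟨ tr-comm disjoint x ⟩
        tr n (y i) (y j) (tr n i j x)       ≡⟨ sym (y-tr-y i≉j (tr n i j x)) ⟩
        conj y (tr n i j) (tr n i j x)      ∎
        where open ≡-Reasoning

  same-conj⇒≐-tr⊎≐-ytry : ∀ {r a b i j} → a ≉ b → r ≐ tr n a b → i ≉ j → y i ≉ j →
    conj r y ≐ conj (tr n i j) y → r ≐ tr n i j ⊎ r ≐ conj y (tr n i j)
  same-conj⇒≐-tr⊎≐-ytry {r} {a} {b} {i} {j} a≉b r≐tab i≉j yi≉j same =
    [ inj₁ ∘ from-i , inj₂ ∘ from-yi ]′ (same-conj⇒Moves r≐tab i≉j (yi≉j ∘ ≈-reflexive) same)
    where
      from-i : Moves a b i → r ≐ tr n i j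
      from-i i-moved = reflection-determined a≉b r≐tab i-moved i≉j same
      yi≉yj : y i ≉ y j
      yi≉yj yi≈yj = i≉j (subst (i ≈_) (involut j) (y-≈ˡ yi≈yj))
      same′ : conj r y ≐ conj (tr n (y i) (y j)) y
      same′ x = begin
        conj r y x                          ≡⟨ same x ⟩
        conj (tr n i j) y x                 ≡⟨ conj-ytry≐conj-tr i≉j yi≉j x ⟨
        conj (conj y (tr n i j)) y x        ≡⟨ conj-congˡ {y = y} (y-tr-y i≉j) x ⟩
        conj (tr n (y i) (y j)) y x         ∎
        where open ≡-Reasoning
      from-yi : Moves a b (y i) → r ≐ conj y (tr n i j)
      from-yi yi-moved x =
        trans (reflection-determined a≉b r≐tab yi-moved yi≉yj same′ x) (sym (y-tr-y i≉j x))

lemma5p2 : (n : ℕ) → 2 ≤ n → 2 ∣ℕ n →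
  (y r : ℤ → ℤ) → IsFPFInvolution n y → IsReflection n r →
  (i j : ℤ) → i < j → ¬ (j ≡ i [mod n ]) →
  ¬ (y ≐ conj (tr n i j) y) →
  ((y i ≡ j [mod n ] → (conj r y ≐ conj (tr n i j) y) ⇔ (r ≐ tr n i j))
   × (¬ (y i ≡ j [mod n ]) →
      (conj r y ≐ conj (tr n i j) y) ⇔ ((r ≐ tr n i j) ⊎ (r ≐ conj y (tr n i j)))))
lemma5p2 n@(suc _) _ _ y r Y (a , b , _ , b≢a , r≐tab) i j _ j≢i nontrivial =
    (λ yi≡j → mk⇔ (same-conj⇒≐-tr a≉b r≐tab i≉j (mk≈ yi≡j) nontrivial) (conj-congˡ {y = y}))
  , (λ yi≢j → mk⇔ (same-conj⇒≐-tr⊎≐-ytry a≉b r≐tab i≉j (yi≢j ∘ get≈))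
                  [ conj-congˡ {y = y} , ≐-ytry⇒same-conj (yi≢j ∘ get≈) ]′)
  where
    open Congruence n
    open FPFInvolution n y Y
    i≉j : i ≉ j
    i≉j = j≢i ∘ get≈ ∘ ≈-sym
    a≉b : a ≉ b
    a≉b = b≢a ∘ get≈ ∘ ≈-sym
    ≐-ytry⇒same-conj : y i ≉ j → r ≐ conj y (tr n i j) → conj r y ≐ conj (tr n i j) y
    ≐-ytry⇒same-conj yi≉j r≐ytry x =
      trans (conj-congˡ {y = y} r≐ytry x) (conj-ytry≐conj-tr i≉j yi≉j x)
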